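{- Let $G$ be a connected graph, $D$ a rooted distribution on $G$ with root $r$, $P$ a path in $G$ having $r$ as an end vertex, and $E$ the rooted distribution on $P$ induced from $D$. If $w(E)>1$ (weight computed on the graph $P$), then $D$ is $r$-excessive on $G$.
   Context: A pebbling distribution assigns to each vertex $v$ a non-negative integer $D(v)$ of pebbles; a rooted distribution fixes a root $r$. A pebbling step $[a,b]$, for adjacent $a,b$, removes two pebbles from $a$ and adds one to $b$. A rooted distribution is $r$-solvable if some sequence of pebbling steps ends with at least one pebble on $r$; it is $r$-critical if it is $r$-solvable but removing any single pebble makes it not $r$-solvable; it is $r$-excessive if it is $r$-solvable but not $r$-critical. For a subgraph $H$ of $G$, the distribution $E$ on $H$ induced from $D$ has the same root as $D$ and $E(a)=D(a)$ for all vertices $a$ of $H$. The weight of a rooted distribution $E$ on a graph $H$ is $w(E)=\sum_{v\in V(H)} E(v)/2^{d_H(v,r)}$, with $d_H$ the distance in $H$. -}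

module Defs where

open import Data.Nat as ℕ using (ℕ; zero; suc; _+_; _∸_; _^_; _≤_)
open import Data.Nat.Properties using (m^n≢0)
open import Data.Fin using (Fin; _≟_)
open import Data.Fin.Properties using ()
open import Data.Vec using (Vec; []; _∷_; lookup; head)
open import Data.Integer using (+_)
open import Data.Rational using (ℚ; 0ℚ; _/_) renaming (_+_ to _+ℚ_)
open import Data.Product using (Σ; ∃; ∃-syntax; _×_; _,_)
open import Data.Empty using (⊥)
open import Relation.Nullary using (¬_; does)
open import Data.Bool using (if_then_else_)
open import Relation.Binary.PropositionalEquality using (_≡_; _≢_)
open import Relation.Binary.Construct.Closure.ReflexiveTransitive using (Star)
open import Level using (0ℓ)

record Graph : Set₁ where
  field
    n     : ℕ
    Adj   : Fin n → Fin n → Set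
    sym   : ∀ {a b} → Adj a b → Adj b a
    irrefl : ∀ {a} → ¬ Adj a a

open Graph public

Connected : Graph → Set
Connected G = ∀ (u v : Fin (n G)) → Star (Adj G) u v

Distribution : Graph → Set
Distribution G = Fin (n G) → ℕ

applyStep : ∀ {G} → Distribution G → Fin (n G) → Fin (n G) → Distribution G
applyStep D a b v =
  (D v ∸ (if does (a ≟ v) then 2 else 0)) + (if does (b ≟ v) then 1 else 0)

Step : (G : Graph) → Distribution G → Distribution G → Set
Step G D D' = ∃[ a ] ∃[ b ] (Adj G a b × 2 ≤ D a × D' ≡ applyStep {G} D a b)

Reachable : (G : Graph) → Distribution G → Distribution G → Set
Reachable G = Star (Step G)

Solvable : (G : Graph) → Fin (n G) → Distribution G → Set
Solvable G r D = ∃[ D' ] (Reachable G D D' × 1 ≤ D' r)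

removePebble : ∀ {G} → Distribution G → Fin (n G) → Distribution G
removePebble D v u = D u ∸ (if does (v ≟ u) then 1 else 0)

Critical : (G : Graph) → Fin (n G) → Distribution G → Set
Critical G r D =
  Solvable G r D × (∀ v → 1 ≤ D v → ¬ Solvable G r (removePebble {G} D v))

Excessive : (G : Graph) → Fin (n G) → Distribution G → Set
Excessive G r D = Solvable G r D × ¬ Critical G r D

record Path (G : Graph) (k : ℕ) : Set where
  field
    verts    : Vec (Fin (n G)) (suc k)
    distinct : ∀ i j → lookup verts i ≡ lookup verts j → i ≡ j
    adjacent : ∀ (i : Fin k) →
      Adj G (lookup verts (Data.Fin.inject₁ i)) (lookup verts (Data.Fin.suc i))

open Path public

-- Weight of the distribution induced on the path, rooted at its first vertex:
-- the vertex at position j of the path has distance j from the root in the path graph,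
-- so it contributes E(v)/2^j.
weightFrom : ∀ {G m} → Distribution G → ℕ → Vec (Fin (n G)) m → ℚ
weightFrom {G} D j [] = 0ℚ
weightFrom {G} D j (v ∷ vs) =
  ((+ D v) / (2 ^ j)) {{m^n≢0 2 j}} +ℚ weightFrom {G} D (suc j) vs

pathWeight : ∀ {G k} → Distribution G → Path G k → ℚ
pathWeight {G} D P = weightFrom {G} D 0 (verts P)

-- Scaling by 2^(k+1), the weight condition says that S = Σⱼ D(vⱼ) 2^(k+1-j), summed along the
-- path v₀ = r, …, v_k, exceeds 2^(k+1). Whenever t 2^(k+1) ≤ S, t pebbles can be gathered on r:
-- the root supplies what it has and requests twice the deficit from v₁, which by induction along
-- the path can deliver it, and since the path does not return to v₀ this never disturbs the root.
-- As S > 2^(k+1) strictly, the same induction finds a pebble whose removal keeps S ≥ 2^(k+1); so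
-- D remains solvable after removing it and is not critical.
module Submission where

open import Defs hiding (sym)
open import Data.Fin as Fin using (Fin; inject₁; _≟_)
import Data.Fin.Properties as Fin
open import Data.Integer as ℤ using (ℤ; +_)
import Data.Integer.Properties as ℤ
open import Data.Nat using (ℕ; zero; suc; _+_; _*_; _∸_; _^_; _≤_; _<_; _≤?_; _<?_; NonZero)
open import Data.Nat.Properties
  using ( +-identityʳ; +-assoc; +-comm; +-suc; +-monoʳ-≤; *-identityˡ; *-assoc; *-distribʳ-+
        ; *-distribʳ-∸; *-monoˡ-≤; *-cancelʳ-≤; *-cancelʳ-<; ∸-monoˡ-≤; ∸-monoˡ-<
        ; m≤m+n; m≤n+m∸n; m≤n+o⇒m∸n≤o; m+n≤o⇒m≤o∸n; m+n∸m≡n; m<n⇒0<n; ≮⇒≥; <⇒≤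
        ; ≤-trans; ≤-<-trans; ≤-reflexive
        ; m*n≢0; m^n≢0; ^-distribˡ-+-*; module ≤-Reasoning)
open import Data.Nat.Tactic.RingSolver using (solve-∀)
open import Data.Product using (∃-syntax; _×_; _,_; proj₁; proj₂)
open import Data.Rational as ℚ using (ℚ; _/_; toℚᵘ; 1ℚ; _>_)
open import Data.Rational.Properties using (toℚᵘ-fromℚᵘ; toℚᵘ-homo-+; toℚᵘ-mono-<)
open import Data.Rational.Unnormalised using (ℚᵘ; mkℚᵘ; _≃_; *≡*; *<*; 0ℚᵘ; 1ℚᵘ)
  renaming (_/_ to _/ᵘ_; _+_ to _+ᵘ_; _<_ to _<ᵘ_)
open import Data.Rational.Unnormalised.Properties
  using (+-cong; ≃-sym; <-respʳ-≃; /-cong; module ≃-Reasoning)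
open import Data.Vec using (Vec; []; _∷_; head; lookup)
open import Data.Vec.Membership.Propositional using (_∈_; _∉_)
open import Data.Vec.Relation.Unary.Any using (here; there; index)
open import Data.Vec.Relation.Unary.Any.Properties using (lookup-index)
open import Function using (_∘_)
open import Relation.Binary.Construct.Closure.ReflexiveTransitive using (ε; _◅_; _◅◅_)
open import Relation.Binary.PropositionalEquality
  using (_≡_; _≢_; refl; sym; trans; cong; cong₂; subst; subst₂; module ≡-Reasoning)
open import Relation.Nullary using (¬_; yes; no)
open import Relation.Nullary.Decidable using (dec-true; dec-false)

m*o≤n*o+p⇒[m∸n]*o≤p : ∀ m n o p → m * o ≤ n * o + p → (m ∸ n) * o ≤ p
m*o≤n*o+p⇒[m∸n]*o≤p m n o p h =
  subst (_≤ p) (sym (*-distribʳ-∸ o m n)) (m≤n+o⇒m∸n≤o (m * o) (n * o) h)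

[m∸n]*o≤p⇒m*o≤n*o+p : ∀ m n o p → (m ∸ n) * o ≤ p → m * o ≤ n * o + p
[m∸n]*o≤p⇒m*o≤n*o+p m n o p h = begin
  m * o               ≤⟨ *-monoˡ-≤ o (m≤n+m∸n m n) ⟩
  (n + (m ∸ n)) * o   ≡⟨ *-distribʳ-+ o n (m ∸ n) ⟩
  n * o + (m ∸ n) * o ≤⟨ +-monoʳ-≤ (n * o) h ⟩
  n * o + p           ∎
  where open ≤-Reasoning

n≤m⇒m*o<n*o+p⇒[m∸n]*o<p : ∀ {m n} o p → n ≤ m → m * o < n * o + p → (m ∸ n) * o < p
n≤m⇒m*o<n*o+p⇒[m∸n]*o<p {m} {n} o p n≤m h = begin-strict
  (m ∸ n) * o       ≡⟨ *-distribʳ-∸ o m n ⟩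
  m * o ∸ n * o     <⟨ ∸-monoˡ-< h (*-monoˡ-≤ o n≤m) ⟩
  n * o + p ∸ n * o ≡⟨ m+n∸m≡n (n * o) p ⟩
  p                 ∎
  where open ≤-Reasoning

toℚᵘ-/ : ∀ i d .{{_ : NonZero d}} → toℚᵘ (i / d) ≃ i /ᵘ d
toℚᵘ-/ i (suc d) = toℚᵘ-fromℚᵘ (mkℚᵘ i d)

0/ᵘd≃0 : ∀ d .{{_ : NonZero d}} → + 0 /ᵘ d ≃ 0ℚᵘ
0/ᵘd≃0 (suc d) = *≡* refl

1<n/d⇒d<n : ∀ n d .{{_ : NonZero d}} → 1ℚᵘ <ᵘ + n /ᵘ d → d < n
1<n/d⇒d<n n (suc d) (*<* 1*d<n*1) =
  ℤ.drop‿+<+ (subst₂ ℤ._<_ (ℤ.*-identityˡ _) (ℤ.*-identityʳ _) 1*d<n*1)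

a/d+b/dk≃[ak+b]/dk : ∀ a b d k .{{_ : NonZero d}} .{{_ : NonZero k}} →
  + a /ᵘ d +ᵘ (+ b /ᵘ (d * k)) {{m*n≢0 d k}} ≃ (+ (a * k + b) /ᵘ (d * k)) {{m*n≢0 d k}}
a/d+b/dk≃[ak+b]/dk a b d@(suc _) k@(suc _) = *≡* (begin
  (+ a ℤ.* + (d * k) ℤ.+ + b ℤ.* + d) ℤ.* + (d * k)
    ≡⟨ cong (ℤ._* + (d * k)) (cong₂ ℤ._+_ (ℤ.pos-* a (d * k)) (ℤ.pos-* b d)) ⟨
  (+ (a * (d * k)) ℤ.+ + (b * d)) ℤ.* + (d * k)
    ≡⟨ cong (ℤ._* + (d * k)) (ℤ.pos-+ (a * (d * k)) (b * d)) ⟨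
  + (a * (d * k) + b * d) ℤ.* + (d * k)
    ≡⟨ ℤ.pos-* (a * (d * k) + b * d) (d * k) ⟨
  + ((a * (d * k) + b * d) * (d * k))
    ≡⟨ cong +_ (cross-multiplied a b d k) ⟩
  + ((a * k + b) * (d * (d * k)))
    ≡⟨ ℤ.pos-* (a * k + b) (d * (d * k)) ⟩
  + (a * k + b) ℤ.* + (d * (d * k)) ∎)
  where
  open ≡-Reasoning
  cross-multiplied : ∀ a b d k → (a * (d * k) + b * d) * (d * k) ≡ (a * k + b) * (d * (d * k))
  cross-multiplied = solve-∀

infixl 7 _/2^_
_/2^_ : ℤ → ℕ → ℚᵘ
i /2^ e = (i /ᵘ 2 ^ e) {{m^n≢0 2 e}}

scaledWeight : ∀ {A : Set} {m} → (A → ℕ) → Vec A m → ℕ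
scaledWeight f [] = 0
scaledWeight {m = suc m} f (v ∷ vs) = f v * 2 ^ suc m + scaledWeight f vs

weightFrom≃scaledWeight : ∀ {G} (D : Distribution G) j {m} (vs : Vec (Fin (n G)) m) →
  toℚᵘ (weightFrom {G} D j vs) ≃ + scaledWeight D vs /2^ (j + m)
weightFrom≃scaledWeight D j [] = ≃-sym (0/ᵘd≃0 (2 ^ (j + 0)) {{m^n≢0 2 (j + 0)}})
weightFrom≃scaledWeight {G} D j {suc m} (v ∷ vs) = begin
  toℚᵘ (first ℚ.+ weightFrom {G} D (suc j) vs)
    ≈⟨ toℚᵘ-homo-+ first (weightFrom {G} D (suc j) vs) ⟩
  toℚᵘ first +ᵘ toℚᵘ (weightFrom {G} D (suc j) vs)
    ≈⟨ +-cong (toℚᵘ-/ (+ D v) (2 ^ j)) (weightFrom≃scaledWeight D (suc j) vs) ⟩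
  + D v /2^ j +ᵘ + scaledWeight D vs /2^ (suc j + m)
    ≡⟨ cong (+ D v /2^ j +ᵘ_) (/-cong refl 2^[1+j+m]≡2^j*2^[1+m]) ⟩
  + D v /2^ j +ᵘ + scaledWeight D vs /ᵘ (2 ^ j * 2 ^ suc m)
    ≈⟨ a/d+b/dk≃[ak+b]/dk (D v) (scaledWeight D vs) (2 ^ j) (2 ^ suc m) ⟩
  + scaledWeight D (v ∷ vs) /ᵘ (2 ^ j * 2 ^ suc m)
    ≡⟨ /-cong refl (^-distribˡ-+-* 2 j (suc m)) ⟨
  + scaledWeight D (v ∷ vs) /2^ (j + suc m) ∎
  where
  open ≃-Reasoning
  instance
    2^j≢0       = m^n≢0 2 j
    2^[1+m]≢0   = m^n≢0 2 (suc m)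
    2^[1+j+m]≢0 = m^n≢0 2 (suc j + m)
    2^[j+1+m]≢0 = m^n≢0 2 (j + suc m)
    2^j*2^[1+m]≢0 = m*n≢0 (2 ^ j) (2 ^ suc m)
  first : ℚ
  first = + D v / 2 ^ j
  2^[1+j+m]≡2^j*2^[1+m] : 2 ^ (suc j + m) ≡ 2 ^ j * 2 ^ suc m
  2^[1+j+m]≡2^j*2^[1+m] = trans (cong (2 ^_) (sym (+-suc j m))) (^-distribˡ-+-* 2 j (suc m))

weight>1⇒2^[1+k]<scaledWeight : ∀ {G k} (D : Distribution G) (P : Path G k) →
  pathWeight {G} D P > 1ℚ → 2 ^ suc k < scaledWeight D (verts P)
weight>1⇒2^[1+k]<scaledWeight {k = k} D P w>1 = 1<n/d⇒d<n _ (2 ^ suc k) {{m^n≢0 2 (suc k)}}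
  (<-respʳ-≃ (weightFrom≃scaledWeight D 0 (verts P)) (toℚᵘ-mono-< w>1))

module _ (G : Graph) where

  private
    V : Set
    V = Fin (n G)

  Adj⇒≢ : ∀ {a b} → Adj G a b → a ≢ b
  Adj⇒≢ adj refl = irrefl G adj

  applyStep-source : ∀ (D : Distribution G) {a b} → a ≢ b → applyStep {G} D a b a ≡ D a ∸ 2
  applyStep-source D {a} {b} a≢b
    rewrite dec-true (a ≟ a) refl | dec-false (b ≟ a) (a≢b ∘ sym) = +-identityʳ _

  applyStep-target : ∀ (D : Distribution G) {a b} → a ≢ b → applyStep {G} D a b b ≡ D b + 1
  applyStep-target D {a} {b} a≢b rewrite dec-false (a ≟ b) a≢b | dec-true (b ≟ b) refl = refl

  applyStep-other : ∀ (D : Distribution G) {a b u} → a ≢ u → b ≢ u → applyStep {G} D a b u ≡ D u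
  applyStep-other D {a} {b} {u} a≢u b≢u
    rewrite dec-false (a ≟ u) a≢u | dec-false (b ≟ u) b≢u = +-identityʳ _

  removePebble-self : ∀ (D : Distribution G) v → removePebble {G} D v v ≡ D v ∸ 1
  removePebble-self D v rewrite dec-true (v ≟ v) refl = refl

  removePebble-other : ∀ (D : Distribution G) {v u} → v ≢ u → removePebble {G} D v u ≡ D u
  removePebble-other D {v} {u} v≢u rewrite dec-false (v ≟ u) v≢u = refl

  moves : Distribution G → V → V → ℕ → Distribution G
  moves D a b zero    = D
  moves D a b (suc t) = moves (applyStep {G} D a b) a b t

  moves-target : ∀ (D : Distribution G) {a b} → a ≢ b → ∀ t → moves D a b t b ≡ D b + t
  moves-target D a≢b zero    = sym (+-identityʳ _)
  moves-target D {a} {b} a≢b (suc t) = begin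
    moves (applyStep {G} D a b) a b t b ≡⟨ moves-target _ a≢b t ⟩
    applyStep {G} D a b b + t          ≡⟨ cong (_+ t) (applyStep-target D a≢b) ⟩
    D b + 1 + t                        ≡⟨ +-assoc (D b) 1 t ⟩
    D b + suc t                        ∎
    where open ≡-Reasoning

  moves-other : ∀ (D : Distribution G) {a b u} → a ≢ u → b ≢ u → ∀ t → moves D a b t u ≡ D u
  moves-other D a≢u b≢u zero    = refl
  moves-other D a≢u b≢u (suc t) =
    trans (moves-other _ a≢u b≢u t) (applyStep-other D a≢u b≢u)

  moves-reachable : ∀ (D : Distribution G) {a b} → Adj G a b → ∀ t → t * 2 ≤ D a →
    Reachable G D (moves D a b t)
  moves-reachable D adj zero    _         = ε
  moves-reachable D {a} {b} adj (suc t) 2+t*2≤Da =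
    (a , b , adj , ≤-trans (m≤m+n 2 (t * 2)) 2+t*2≤Da , refl) ◅
    moves-reachable (applyStep {G} D a b) adj t t*2≤Da∸2
    where
    t*2≤Da∸2 : t * 2 ≤ applyStep {G} D a b a
    t*2≤Da∸2 rewrite applyStep-source D (Adj⇒≢ adj) =
      m+n≤o⇒m≤o∸n (t * 2) (subst (_≤ D a) (+-comm 2 (t * 2)) 2+t*2≤Da)

  data IsPath : ∀ {m} → Vec V (suc m) → Set where
    [_]    : ∀ v → IsPath (v ∷ [])
    extend : ∀ {m v u} {vs : Vec V m} → Adj G v u → v ∉ u ∷ vs → IsPath (u ∷ vs) →
             IsPath (v ∷ u ∷ vs)

  Path⇒IsPath : ∀ {k} (P : Path G k) → IsPath (verts P)
  Path⇒IsPath P = go (verts P) (distinct P) (adjacent P)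
    where
    go : ∀ {k} (vs : Vec V (suc k)) → (∀ i j → lookup vs i ≡ lookup vs j → i ≡ j) →
         (∀ (i : Fin k) → Adj G (lookup vs (inject₁ i)) (lookup vs (Fin.suc i))) → IsPath vs
    go (v ∷ [])     _        _   = [ v ]
    go (v ∷ u ∷ ws) distinct adj =
      extend (adj Fin.zero) v∉u∷ws
        (go (u ∷ ws) (λ i j eq → Fin.suc-injective (distinct (Fin.suc i) (Fin.suc j) eq))
                     (adj ∘ Fin.suc))
      where
      v∉u∷ws : v ∉ u ∷ ws
      v∉u∷ws v∈u∷ws
        with distinct (Fin.suc (index v∈u∷ws)) Fin.zero (sym (lookup-index v∈u∷ws))
      ... | ()

  pebbles-to-head : ∀ {m} {L : Vec V (suc m)} → IsPath L →
    ∀ D t → t * 2 ^ suc m ≤ scaledWeight D L →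
    ∃[ D' ] Reachable G D D' × t ≤ D' (head L) × (∀ u → u ∉ L → D' u ≡ D u)
  pebbles-to-head [ v ] D t t*2≤Dv*2+0 =
    D , ε , *-cancelʳ-≤ t (D v) 2 (subst (t * 2 ≤_) (+-identityʳ _) t*2≤Dv*2+0) , λ _ _ → refl
  pebbles-to-head {suc m} (extend {v = v} {u} {vs} adj v∉u∷vs path) D t t*X≤weight with t ≤? D v
  ... | yes t≤Dv = D , ε , t≤Dv , λ _ _ → refl
  ... | no _     =
    D₂ , D↠D₁ ◅◅ moves-reachable D₁ (Graph.sym G adj) s s*2≤D₁u , t≤D₂v , D₂-unchanged
    where
    s = t ∸ D v
    Y = 2 ^ suc m
    demand : s * 2 * Y ≤ scaledWeight D (u ∷ vs)
    demand = subst (_≤ scaledWeight D (u ∷ vs)) (sym (*-assoc s 2 Y))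
      (m*o≤n*o+p⇒[m∸n]*o≤p t (D v) (2 * Y) (scaledWeight D (u ∷ vs)) t*X≤weight)
    u≢v : u ≢ v
    u≢v = Adj⇒≢ (Graph.sym G adj)
    ih = pebbles-to-head path D (s * 2) demand
    D₁ = proj₁ ih
    D↠D₁ = proj₁ (proj₂ ih)
    s*2≤D₁u = proj₁ (proj₂ (proj₂ ih))
    D₁-unchanged = proj₂ (proj₂ (proj₂ ih))
    D₂ = moves D₁ u v s
    t≤D₂v : t ≤ D₂ v
    t≤D₂v rewrite moves-target D₁ u≢v s | D₁-unchanged v v∉u∷vs = m≤n+m∸n t (D v)
    D₂-unchanged : ∀ w → w ∉ v ∷ u ∷ vs → D₂ w ≡ D w
    D₂-unchanged w w∉L =
      trans (moves-other D₁ (w∉L ∘ there ∘ here ∘ sym) (w∉L ∘ here ∘ sym) s)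
            (D₁-unchanged w (w∉L ∘ there))

  remove-at-head : ∀ (D : Distribution G) {m} v (vs : Vec V m) t → t < D v →
    t * 2 ^ suc m ≤ scaledWeight (removePebble {G} D v) (v ∷ vs)
  remove-at-head D {m} v vs t t<Dv = begin
    t * 2 ^ suc m                            ≤⟨ *-monoˡ-≤ (2 ^ suc m) (∸-monoˡ-≤ 1 t<Dv) ⟩
    (D v ∸ 1) * 2 ^ suc m                    ≡⟨ cong (_* 2 ^ suc m) (removePebble-self D v) ⟨
    removePebble {G} D v v * 2 ^ suc m       ≤⟨ m≤m+n _ _ ⟩
    scaledWeight (removePebble {G} D v) (v ∷ vs) ∎
    where open ≤-Reasoning

  removable-pebble : ∀ {m} {L : Vec V (suc m)} → IsPath L →
    ∀ D t → t * 2 ^ suc m < scaledWeight D L →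
    ∃[ w ] w ∈ L × 1 ≤ D w × t * 2 ^ suc m ≤ scaledWeight (removePebble {G} D w) L
  removable-pebble [ v ] D t t*2<Dv*2+0 =
    v , here refl , m<n⇒0<n t<Dv , remove-at-head D v [] t t<Dv
    where
    t<Dv : t < D v
    t<Dv = *-cancelʳ-< 2 t (D v) (subst (t * 2 <_) (+-identityʳ _) t*2<Dv*2+0)
  removable-pebble {suc m} (extend {v = v} {u} {vs} adj v∉u∷vs path) D t t*X<weight with t <? D v
  ... | yes t<Dv = v , here refl , m<n⇒0<n t<Dv , remove-at-head D v (u ∷ vs) t t<Dv
  ... | no t≮Dv  = w , there w∈u∷vs , 1≤Dw , t*X≤weight′
    where
    s = t ∸ D v
    Y = 2 ^ suc m
    demand : s * 2 * Y < scaledWeight D (u ∷ vs)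
    demand = subst (_< scaledWeight D (u ∷ vs)) (sym (*-assoc s 2 Y))
      (n≤m⇒m*o<n*o+p⇒[m∸n]*o<p (2 * Y) (scaledWeight D (u ∷ vs)) (≮⇒≥ t≮Dv) t*X<weight)
    ih = removable-pebble path D (s * 2) demand
    w = proj₁ ih
    w∈u∷vs = proj₁ (proj₂ ih)
    1≤Dw = proj₁ (proj₂ (proj₂ ih))
    D′ = removePebble {G} D w
    w≢v : w ≢ v
    w≢v w≡v = v∉u∷vs (subst (_∈ u ∷ vs) w≡v w∈u∷vs)
    t*X≤weight′ : t * (2 * Y) ≤ D′ v * (2 * Y) + scaledWeight D′ (u ∷ vs)
    t*X≤weight′ rewrite removePebble-other D w≢v =
      [m∸n]*o≤p⇒m*o≤n*o+p t (D v) (2 * Y) (scaledWeight D′ (u ∷ vs))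
        (subst (_≤ scaledWeight D′ (u ∷ vs)) (*-assoc s 2 Y) (proj₂ (proj₂ (proj₂ ih))))

  path-solvable : ∀ {m} {L : Vec V (suc m)} → IsPath L → ∀ D → 2 ^ suc m ≤ scaledWeight D L →
    Solvable G (head L) D
  path-solvable path D 2^[1+m]≤weight
    with pebbles-to-head path D 1 (≤-trans (≤-reflexive (*-identityˡ _)) 2^[1+m]≤weight)
  ... | D′ , D↠D′ , 1≤D′r , _ = D′ , D↠D′ , 1≤D′r

lemma16 : (G : Graph) → Connected G → (r : Fin (n G)) → (D : Distribution G)
    → (k : ℕ) → (P : Path G k) → head (verts P) ≡ r
    → pathWeight {G} D P > 1ℚ
    → Excessive G r D
lemma16 G _ r D k P refl w>1 = path-solvable G path D (<⇒≤ 2^[1+k]<weight) , not-critical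
  where
  path = Path⇒IsPath G P
  2^[1+k]<weight = weight>1⇒2^[1+k]<scaledWeight D P w>1
  not-critical : ¬ Critical G r D
  not-critical (_ , critical)
    with removable-pebble G path D 1 (≤-<-trans (≤-reflexive (*-identityˡ _)) 2^[1+k]<weight)
  ... | w , _ , 1≤Dw , 1*2^[1+k]≤weight′ =
    critical w 1≤Dw
      (path-solvable G path _ (≤-trans (≤-reflexive (sym (*-identityˡ _))) 1*2^[1+k]≤weight′))
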